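{- Let $0 \leq d \leq n$ and $s \geq 1$ be integers and let $\mathcal F_1,\dots,\mathcal F_s \subset 2^{[n]}$ be $d$-cross-dependent. Then \[ \sum_{1 \leq i \leq s} \|\mathcal F_i\|_n \leq (n+1)s - (d+1). \]
   Context: $[n]=\{1,\dots,n\}$. For $\mathcal F \subset 2^{[n]}$ the binomial norm is $\|\mathcal F\|_n = \sum_{F \in \mathcal F} 1\big/\binom{n}{|F|}$. Families $\mathcal F_1,\dots,\mathcal F_s \subset 2^{[n]}$ are $d$-cross-dependent if there is no choice of pairwise disjoint $F_1 \in \mathcal F_1,\dots,F_s \in \mathcal F_s$ with $|F_1 \cup \dots \cup F_s| \leq d$. -}

module Defs where

open import Data.Bool using (Bool; true; false; if_then_else_)
open import Data.Nat using (ℕ; zero; suc; _+_; _*_; _≤_)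
open import Data.Nat.Combinatorics using (_C_)
open import Data.Integer using (+_)
open import Data.Fin using (Fin)
open import Data.Fin.Subset using (Subset; ∣_∣; _∩_; ⋃; Empty)
open import Data.Vec using ([]; _∷_)
open import Data.List using (List; []; _∷_; map; _++_; foldr)
import Data.List as List
open import Data.Rational using (ℚ; 0ℚ; _/_)
import Data.Rational as ℚ
open import Data.Empty using (⊥)
open import Relation.Binary.PropositionalEquality using (_≡_; _≢_)

allSubsets : (n : ℕ) → List (Subset n)
allSubsets zero    = [] ∷ []
allSubsets (suc n) = map (false ∷_) (allSubsets n) ++ map (true ∷_) (allSubsets n)

-- Reciprocal of a natural number as a rational; the value at 0 is irrelevant
-- (it is only applied to binomial coefficients n C k with k ≤ n, which are ≥ 1).
invℕ : ℕ → ℚ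
invℕ zero    = 0ℚ
invℕ (suc m) = + 1 / suc m

sumℚ : List ℚ → ℚ
sumℚ = foldr ℚ._+_ 0ℚ

Family : ℕ → Set
Family n = Subset n → Bool

binomNorm : (n : ℕ) → Family n → ℚ
binomNorm n 𝓕 = sumℚ (List.map (λ F → if 𝓕 F then invℕ (n C ∣ F ∣) else 0ℚ) (allSubsets n))

CrossDependent : (n d s : ℕ) → (Fin s → Family n) → Set
CrossDependent n d s 𝓕 =
  (F : Fin s → Subset n) →
  ((i : Fin s) → 𝓕 i (F i) ≡ true) →
  ((i j : Fin s) → i ≢ j → Empty (F i ∩ F j)) →
  ∣ ⋃ (List.tabulate F) ∣ ≤ d → ⊥

-- For a family F ⊆ 2^[N], a point x and b ∈ {true, false}, let F[x ≔ b] be the family on the remaining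
-- N - 1 points obtained from the members of F whose x-membership is b.  Double counting, with the
-- absorption identity k·C(N,k) = N·C(N-1,k-1), gives
--   N‖F‖_N = Σₓ ‖F[x ≔ true]‖_{N-1} + N·[∅ ∈ F],
-- and complementation turns this into N‖F‖_N = Σₓ ‖F[x ≔ false]‖_{N-1} + N·[[N] ∈ F].
-- The theorem follows by induction on d.  Cross-dependence always forces some Fⱼ to omit ∅.  For d = 0
-- the identity gives ‖F‖_n ≤ n + [∅ ∈ F], and summing yields the claim.  For d > 0 restrict Fⱼ to the
-- sets containing x and every other family to the sets avoiding x: the restricted families stay
-- (d - 1)-cross-dependent, so the induction hypothesis holds for each x, and summing the identities
-- over the families and the hypotheses over x gives N times the claim.

module Submission where

open import Algebra.Bundles using (CommutativeMonoid)
open import Data.Bool using (Bool; true; false; not; _∧_; _∨_; if_then_else_)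
import Data.Bool as Bool
open import Data.Bool.ListAction using (or)
open import Data.Bool.Properties using (if-eta; ¬-not)
open import Data.Empty using (⊥-elim)
open import Data.Fin using (Fin; zero; suc; _≟_)
open import Data.Fin.Properties using (¬∀⟶∃¬)
open import Data.Fin.Subset using (Subset; ∣_∣; ∁; ⊥; ⊤; _∩_; _∪_; ⋃; Empty)
open import Data.Fin.Subset.Properties
  using (∉⊥; ∪-identityˡ; ∩-zeroˡ; Empty-unique; ∣p∣≤n; ∣∁p∣≡n∸∣p∣; ∣⊥∣≡0)
import Data.Integer as ℤ
import Data.Integer.Properties as ℤ
open import Data.List using (List; []; _∷_; _++_; map; allFin; tabulate)
import Data.List.Properties as List
open import Data.Nat as ℕ using (ℕ; zero; suc; _∸_; _≡ᵇ_; z≤n; s≤s)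
import Data.Nat.Properties as ℕ
open import Data.Nat.Combinatorics using (_C_; nCk+nC[k+1]≡[n+1]C[k+1]; nCk≡nC[n∸k]; nC1≡n)
open import Data.Nat.Coprimality using (1-coprimeTo) renaming (sym to coprime-sym)
open import Data.Nat.Tactic.RingSolver using (solve-∀)
open import Data.Product using (∃; _,_; map₂)
open import Data.Rational using (ℚ; 0ℚ; 1ℚ; _+_; _*_; _-_; -_; _≤_; *≤*; _/_; mkℚ)
open import Data.Rational.Properties hiding (_≟_)
open import Data.Rational.Solver using (module +-*-Solver)
open import Data.Vec using (Vec; []; _∷_; lookup; replicate; insertAt; zipWith)
open import Data.Vec.Properties using (insertAt-lookup; map-insertAt; map-replicate)
open import Function using (_∘_; id)
open import Relation.Binary.PropositionalEquality
open import Relation.Nullary using (¬_; yes; no; does)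
open import Relation.Nullary.Decidable using (dec-true)

open import Algebra.Properties.CommutativeSemigroup
  (CommutativeMonoid.commutativeSemigroup +-0-commutativeMonoid)
  using () renaming (interchange to +-interchange)

open import Defs

-- Natural numbers as rationals

fromℕ : ℕ → ℚ
fromℕ n = ℤ.+ n / 1

fromℕ≡mkℚ : ∀ n → fromℕ n ≡ mkℚ (ℤ.+ n) 0 (coprime-sym (1-coprimeTo n))
fromℕ≡mkℚ n = normalize-coprime (coprime-sym (1-coprimeTo n))

invℕ≡mkℚ : ∀ n → invℕ (suc n) ≡ mkℚ (ℤ.+ 1) n (1-coprimeTo (suc n))
invℕ≡mkℚ n = normalize-coprime (1-coprimeTo (suc n))

fromℕ-+ : ∀ m n → fromℕ (m ℕ.+ n) ≡ fromℕ m + fromℕ n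
fromℕ-+ m n rewrite fromℕ≡mkℚ m | fromℕ≡mkℚ n =
  cong (_/ 1) (cong₂ ℤ._+_ (sym (ℤ.*-identityʳ (ℤ.+ m))) (sym (ℤ.*-identityʳ (ℤ.+ n))))

fromℕ-* : ∀ m n → fromℕ (m ℕ.* n) ≡ fromℕ m * fromℕ n
fromℕ-* m n rewrite fromℕ≡mkℚ m | fromℕ≡mkℚ n = cong (_/ 1) (ℤ.pos-* m n)

fromℕ-mono-≤ : ∀ {m n} → m ℕ.≤ n → fromℕ m ≤ fromℕ n
fromℕ-mono-≤ {m} {n} m≤n rewrite fromℕ≡mkℚ m | fromℕ≡mkℚ n =
  *≤* (ℤ.*-monoʳ-≤-nonNeg (ℤ.+ 1) (ℤ.+≤+ m≤n))

fromℕ-suc-* : ∀ n c → fromℕ (suc n) * c ≡ c + fromℕ n * c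
fromℕ-suc-* n c = begin
  fromℕ (suc n) * c      ≡⟨ cong (_* c) (fromℕ-+ 1 n) ⟩
  (1ℚ + fromℕ n) * c     ≡⟨ *-distribʳ-+ c 1ℚ (fromℕ n) ⟩
  1ℚ * c + fromℕ n * c   ≡⟨ cong (_+ fromℕ n * c) (*-identityˡ c) ⟩
  c + fromℕ n * c        ∎
  where open ≡-Reasoning

fromℕ-*-invℕ : ∀ n → fromℕ (suc n) * invℕ (suc n) ≡ 1ℚ
fromℕ-*-invℕ n rewrite fromℕ≡mkℚ (suc n) | invℕ≡mkℚ n =
  *-inverseʳ (mkℚ (ℤ.+ suc n) 0 (coprime-sym (1-coprimeTo (suc n))))

fromℕ-suc-*-cancelˡ-≤ : ∀ n {p q} → fromℕ (suc n) * p ≤ fromℕ (suc n) * q → p ≤ q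
fromℕ-suc-*-cancelˡ-≤ n h rewrite fromℕ≡mkℚ (suc n) = *-cancelˡ-≤-pos (mkℚ (ℤ.+ suc n) 0 _) h

fromℕ-*-invℕ-cross : ∀ {a b c d} → 0 ℕ.< c → 0 ℕ.< d → a ℕ.* c ≡ b ℕ.* d →
  fromℕ a * invℕ d ≡ fromℕ b * invℕ c
fromℕ-*-invℕ-cross {a} {b} {suc c} {suc d} _ _ ac≡bd = begin
  p * y             ≡⟨ *-identityʳ (p * y) ⟨
  p * y * 1ℚ        ≡⟨ cong (p * y *_) (fromℕ-*-invℕ c) ⟨
  p * y * (r * x)   ≡⟨ solve 4 (λ p y r x → p :* y :* (r :* x) := p :* r :* (x :* y)) refl p y r x ⟩
  p * r * (x * y)   ≡⟨ cong (_* (x * y)) pr≡qt ⟩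
  q * t * (x * y)   ≡⟨ solve 4 (λ q t x y → q :* t :* (x :* y) := q :* x :* (t :* y)) refl q t x y ⟩
  q * x * (t * y)   ≡⟨ cong (q * x *_) (fromℕ-*-invℕ d) ⟩
  q * x * 1ℚ        ≡⟨ *-identityʳ (q * x) ⟩
  q * x             ∎
  where
  open ≡-Reasoning
  open +-*-Solver
  p = fromℕ a; q = fromℕ b; r = fromℕ (suc c); t = fromℕ (suc d)
  x = invℕ (suc c); y = invℕ (suc d)
  pr≡qt : p * r ≡ q * t
  pr≡qt = trans (sym (fromℕ-* a (suc c))) (trans (cong fromℕ ac≡bd) (fromℕ-* b (suc d)))

*-if-1-0 : ∀ p b → p * (if b then 1ℚ else 0ℚ) ≡ (if b then p else 0ℚ)
*-if-1-0 p true  = *-identityʳ p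
*-if-1-0 p false = *-zeroʳ p

if-1-0-≤-1 : ∀ b → (if b then 1ℚ else 0ℚ) ≤ 1ℚ
if-1-0-≤-1 true  = ≤-refl
if-1-0-≤-1 false = fromℕ-mono-≤ {0} {1} z≤n

if-then-0-≤ : ∀ c {p} → 0ℚ ≤ p → (if c then p else 0ℚ) ≤ p
if-then-0-≤ true  0≤p = ≤-refl
if-then-0-≤ false 0≤p = 0≤p

-- Finite sums

∑ : {A : Set} → List A → (A → ℚ) → ℚ
∑ xs f = sumℚ (map f xs)

syntax ∑ xs (λ x → e) = ∑[ x ∈ xs ] e

module _ {A : Set} where

  ∑-++ : ∀ (xs ys : List A) f → ∑ (xs ++ ys) f ≡ ∑ xs f + ∑ ys f
  ∑-++ []       ys f = sym (+-identityˡ (∑ ys f))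
  ∑-++ (x ∷ xs) ys f = trans (cong (f x +_) (∑-++ xs ys f)) (sym (+-assoc (f x) (∑ xs f) (∑ ys f)))

  ∑-cong : ∀ (xs : List A) {f g} → (∀ x → f x ≡ g x) → ∑ xs f ≡ ∑ xs g
  ∑-cong []       f≗g = refl
  ∑-cong (x ∷ xs) f≗g = cong₂ _+_ (f≗g x) (∑-cong xs f≗g)

  ∑-0 : ∀ (xs : List A) → ∑[ x ∈ xs ] 0ℚ ≡ 0ℚ
  ∑-0 []       = refl
  ∑-0 (x ∷ xs) = trans (+-identityˡ _) (∑-0 xs)

  ∑-distrib-+ : ∀ (xs : List A) f g → ∑[ x ∈ xs ] (f x + g x) ≡ ∑ xs f + ∑ xs g
  ∑-distrib-+ []       f g = refl
  ∑-distrib-+ (x ∷ xs) f g =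
    trans (cong (f x + g x +_) (∑-distrib-+ xs f g)) (+-interchange (f x) (g x) (∑ xs f) (∑ xs g))

  *-distribˡ-∑ : ∀ c (xs : List A) f → c * ∑ xs f ≡ ∑[ x ∈ xs ] (c * f x)
  *-distribˡ-∑ c []       f = *-zeroʳ c
  *-distribˡ-∑ c (x ∷ xs) f =
    trans (*-distribˡ-+ c (f x) (∑ xs f)) (cong (c * f x +_) (*-distribˡ-∑ c xs f))

  ∑-mono-≤ : ∀ (xs : List A) {f g} → (∀ x → f x ≤ g x) → ∑ xs f ≤ ∑ xs g
  ∑-mono-≤ []       f≤g = ≤-refl
  ∑-mono-≤ (x ∷ xs) f≤g = +-mono-≤ (f≤g x) (∑-mono-≤ xs f≤g)

∑-comm : ∀ {A B : Set} (xs : List A) (ys : List B) (f : A → B → ℚ) →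
  ∑[ x ∈ xs ] ∑[ y ∈ ys ] f x y ≡ ∑[ y ∈ ys ] ∑[ x ∈ xs ] f x y
∑-comm []       ys f = sym (∑-0 ys)
∑-comm (x ∷ xs) ys f =
  trans (cong (∑ ys (f x) +_) (∑-comm xs ys f)) (sym (∑-distrib-+ ys (f x) (λ y → ∑[ x ∈ xs ] f x y)))

∑-map : ∀ {A B : Set} (g : A → B) (xs : List A) f → ∑ (map g xs) f ≡ ∑ xs (f ∘ g)
∑-map g xs f = cong sumℚ (sym (List.map-∘ xs))

∑-allFin-suc : ∀ n (f : Fin (suc n) → ℚ) → ∑ (allFin (suc n)) f ≡ f zero + ∑ (allFin n) (f ∘ suc)
∑-allFin-suc n f =
  cong (f zero +_) (cong sumℚ (trans (List.map-tabulate suc f) (sym (List.map-tabulate id (f ∘ suc)))))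

∑-allFin-const : ∀ n c → ∑[ i ∈ allFin n ] c ≡ fromℕ n * c
∑-allFin-const zero    c = sym (*-zeroˡ c)
∑-allFin-const (suc n) c = begin
  ∑[ i ∈ allFin (suc n) ] c   ≡⟨ ∑-allFin-suc n (λ _ → c) ⟩
  c + ∑[ i ∈ allFin n ] c     ≡⟨ cong (c +_) (∑-allFin-const n c) ⟩
  c + fromℕ n * c             ≡⟨ fromℕ-suc-* n c ⟨
  fromℕ (suc n) * c           ∎
  where open ≡-Reasoning

∑-allFin-lookup : ∀ {n} (A : Subset n) c →
  ∑[ x ∈ allFin n ] (if lookup A x then c else 0ℚ) ≡ fromℕ ∣ A ∣ * c
∑-allFin-lookup         []      c = sym (*-zeroˡ c)
∑-allFin-lookup {suc n} (a ∷ A) c =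
  trans (∑-allFin-suc n (λ x → if lookup (a ∷ A) x then c else 0ℚ)) (head-step a)
  where
  head-step : ∀ a →
    (if a then c else 0ℚ) + ∑[ x ∈ allFin n ] (if lookup A x then c else 0ℚ) ≡ fromℕ ∣ a ∷ A ∣ * c
  head-step true  = trans (cong (c +_) (∑-allFin-lookup A c)) (sym (fromℕ-suc-* ∣ A ∣ c))
  head-step false = trans (+-identityˡ _) (∑-allFin-lookup A c)

∑-allFin-≤-+ : ∀ n {f g : Fin n → ℚ} c → (∀ i → f i ≤ g i + c) →
  ∑ (allFin n) f ≤ ∑ (allFin n) g + fromℕ n * c
∑-allFin-≤-+ n {f} {g} c f≤g+c = begin
  ∑ (allFin n) f                         ≤⟨ ∑-mono-≤ (allFin n) f≤g+c ⟩
  ∑[ i ∈ allFin n ] (g i + c)            ≡⟨ ∑-distrib-+ (allFin n) g (λ _ → c) ⟩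
  ∑ (allFin n) g + ∑[ i ∈ allFin n ] c   ≡⟨ cong (∑ (allFin n) g +_) (∑-allFin-const n c) ⟩
  ∑ (allFin n) g + fromℕ n * c           ∎
  where open ≤-Reasoning

∑-allFin-≤-+-except : ∀ {n} (j : Fin n) {f g : Fin n → ℚ} c → (∀ i → f i ≤ g i + c) → f j ≤ g j →
  ∑ (allFin n) f + c ≤ ∑ (allFin n) g + fromℕ n * c
∑-allFin-≤-+-except {suc n} zero {f} {g} c f≤g+c f₀≤g₀ = begin
  ∑ (allFin (suc n)) f + c                   ≡⟨ cong (_+ c) (∑-allFin-suc n f) ⟩
  f zero + ∑ (allFin n) (f ∘ suc) + c        ≤⟨ +-monoˡ-≤ c (+-mono-≤ f₀≤g₀ (∑-allFin-≤-+ n c (f≤g+c ∘ suc))) ⟩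
  g zero + (∑ (allFin n) (g ∘ suc) + nc) + c
    ≡⟨ solve 4 (λ g₀ G nc c → g₀ :+ (G :+ nc) :+ c := g₀ :+ G :+ (c :+ nc)) refl
               (g zero) (∑ (allFin n) (g ∘ suc)) nc c ⟩
  g zero + ∑ (allFin n) (g ∘ suc) + (c + nc) ≡⟨ cong₂ _+_ (∑-allFin-suc n g) (fromℕ-suc-* n c) ⟨
  ∑ (allFin (suc n)) g + fromℕ (suc n) * c   ∎
  where
  open ≤-Reasoning
  open +-*-Solver
  nc = fromℕ n * c
∑-allFin-≤-+-except {suc n} (suc j) {f} {g} c f≤g+c fⱼ≤gⱼ = begin
  ∑ (allFin (suc n)) f + c                   ≡⟨ cong (_+ c) (∑-allFin-suc n f) ⟩
  f zero + ∑ (allFin n) (f ∘ suc) + c        ≡⟨ +-assoc (f zero) _ c ⟩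
  f zero + (∑ (allFin n) (f ∘ suc) + c)
    ≤⟨ +-mono-≤ (f≤g+c zero) (∑-allFin-≤-+-except j c (f≤g+c ∘ suc) fⱼ≤gⱼ) ⟩
  g zero + c + (∑ (allFin n) (g ∘ suc) + nc) ≡⟨ +-interchange (g zero) c _ nc ⟩
  g zero + ∑ (allFin n) (g ∘ suc) + (c + nc) ≡⟨ cong₂ _+_ (∑-allFin-suc n g) (fromℕ-suc-* n c) ⟨
  ∑ (allFin (suc n)) g + fromℕ (suc n) * c   ∎
  where
  open ≤-Reasoning
  nc = fromℕ n * c

-- Subsets

module _ {A : Set} where

  zipWith-insertAt : ∀ {n} (f : A → A → A) (xs ys : Vec A n) (i : Fin (suc n)) x y →
    zipWith f (insertAt xs i x) (insertAt ys i y) ≡ insertAt (zipWith f xs ys) i (f x y)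
  zipWith-insertAt f xs       ys       zero    x y = refl
  zipWith-insertAt f (u ∷ xs) (v ∷ ys) (suc i) x y = cong (f u v ∷_) (zipWith-insertAt f xs ys i x y)

  insertAt-replicate : ∀ n (i : Fin (suc n)) (x : A) →
    insertAt (replicate n x) i x ≡ replicate (suc n) x
  insertAt-replicate n       zero    x = refl
  insertAt-replicate (suc n) (suc i) x = cong (x ∷_) (insertAt-replicate n i x)

∣insertAt-true∣ : ∀ {n} (p : Subset n) i → ∣ insertAt p i true ∣ ≡ suc ∣ p ∣
∣insertAt-true∣ p            zero    = refl
∣insertAt-true∣ (true  ∷ p) (suc i) = cong suc (∣insertAt-true∣ p i)
∣insertAt-true∣ (false ∷ p) (suc i) = ∣insertAt-true∣ p i

∣insertAt-false∣ : ∀ {n} (p : Subset n) i → ∣ insertAt p i false ∣ ≡ ∣ p ∣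
∣insertAt-false∣ p            zero    = refl
∣insertAt-false∣ (true  ∷ p) (suc i) = cong suc (∣insertAt-false∣ p i)
∣insertAt-false∣ (false ∷ p) (suc i) = ∣insertAt-false∣ p i

∣insertAt∣≤1+∣p∣ : ∀ {n} (p : Subset n) i c → ∣ insertAt p i c ∣ ℕ.≤ suc ∣ p ∣
∣insertAt∣≤1+∣p∣ p i true  = ℕ.≤-reflexive (∣insertAt-true∣ p i)
∣insertAt∣≤1+∣p∣ p i false = ℕ.≤-trans (ℕ.≤-reflexive (∣insertAt-false∣ p i)) (ℕ.n≤1+n ∣ p ∣)

⋃-tabulate-insertAt : ∀ {n} s (ps : Fin s → Subset n) (cs : Fin s → Bool) i →
  ⋃ (tabulate (λ k → insertAt (ps k) i (cs k))) ≡ insertAt (⋃ (tabulate ps)) i (or (tabulate cs))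
⋃-tabulate-insertAt {n} zero    ps cs i = sym (insertAt-replicate n i false)
⋃-tabulate-insertAt     (suc s) ps cs i = trans
  (cong (insertAt (ps zero) i (cs zero) ∪_) (⋃-tabulate-insertAt s (ps ∘ suc) (cs ∘ suc) i))
  (zipWith-insertAt _∨_ (ps zero) (⋃ (tabulate (ps ∘ suc))) i (cs zero) (or (tabulate (cs ∘ suc))))

⋃-tabulate-⊥ : ∀ {n} s → ⋃ (tabulate {n = s} (λ _ → ⊥ {n})) ≡ ⊥
⋃-tabulate-⊥ zero    = refl
⋃-tabulate-⊥ (suc s) = trans (cong (⊥ ∪_) (⋃-tabulate-⊥ s)) (∪-identityˡ ⊥)

Empty-⊥ : ∀ {n} → Empty (⊥ {n})
Empty-⊥ (x , x∈⊥) = ∉⊥ x∈⊥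

∑-allSubsets-suc : ∀ n (h : Subset (suc n) → ℚ) →
  ∑ (allSubsets (suc n)) h ≡ ∑[ B ∈ allSubsets n ] h (false ∷ B) + ∑[ B ∈ allSubsets n ] h (true ∷ B)
∑-allSubsets-suc n h = trans (∑-++ (map (false ∷_) (allSubsets n)) _ h)
  (cong₂ _+_ (∑-map (false ∷_) (allSubsets n) h) (∑-map (true ∷_) (allSubsets n) h))

∑-allSubsets-insertAt : ∀ n (i : Fin (suc n)) (h : Subset (suc n) → ℚ) →
  ∑ (allSubsets (suc n)) h
    ≡ ∑[ B ∈ allSubsets n ] h (insertAt B i false) + ∑[ B ∈ allSubsets n ] h (insertAt B i true)
∑-allSubsets-insertAt n       zero    h = ∑-allSubsets-suc n h
∑-allSubsets-insertAt (suc n) (suc i) h = begin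
  ∑ (allSubsets (suc (suc n))) h
    ≡⟨ ∑-allSubsets-suc (suc n) h ⟩
  ∑[ B ∈ allSubsets (suc n) ] h (false ∷ B) + ∑[ B ∈ allSubsets (suc n) ] h (true ∷ B)
    ≡⟨ cong₂ _+_ (∑-allSubsets-insertAt n i (h ∘ (false ∷_))) (∑-allSubsets-insertAt n i (h ∘ (true ∷_))) ⟩
  (∑ₕ false false + ∑ₕ false true) + (∑ₕ true false + ∑ₕ true true)
    ≡⟨ +-interchange (∑ₕ false false) (∑ₕ false true) (∑ₕ true false) (∑ₕ true true) ⟩
  (∑ₕ false false + ∑ₕ true false) + (∑ₕ false true + ∑ₕ true true)
    ≡⟨ cong₂ _+_ (∑-allSubsets-suc n (h ∘ λ B → insertAt B (suc i) false))
                 (∑-allSubsets-suc n (h ∘ λ B → insertAt B (suc i) true)) ⟨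
  ∑[ B ∈ allSubsets (suc n) ] h (insertAt B (suc i) false)
    + ∑[ B ∈ allSubsets (suc n) ] h (insertAt B (suc i) true) ∎
  where
  open ≡-Reasoning
  ∑ₕ : Bool → Bool → ℚ
  ∑ₕ a c = ∑[ B ∈ allSubsets n ] h (a ∷ insertAt B i c)

∑-allSubsets-∁ : ∀ n (h : Subset n → ℚ) → ∑[ A ∈ allSubsets n ] h (∁ A) ≡ ∑ (allSubsets n) h
∑-allSubsets-∁ zero    h = refl
∑-allSubsets-∁ (suc n) h = begin
  ∑[ A ∈ allSubsets (suc n) ] h (∁ A)
    ≡⟨ ∑-allSubsets-suc n (h ∘ ∁) ⟩
  ∑[ B ∈ allSubsets n ] h (true ∷ ∁ B) + ∑[ B ∈ allSubsets n ] h (false ∷ ∁ B)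
    ≡⟨ cong₂ _+_ (∑-allSubsets-∁ n (h ∘ (true ∷_))) (∑-allSubsets-∁ n (h ∘ (false ∷_))) ⟩
  ∑[ B ∈ allSubsets n ] h (true ∷ B) + ∑[ B ∈ allSubsets n ] h (false ∷ B)
    ≡⟨ +-comm (∑[ B ∈ allSubsets n ] h (true ∷ B)) (∑[ B ∈ allSubsets n ] h (false ∷ B)) ⟩
  ∑[ B ∈ allSubsets n ] h (false ∷ B) + ∑[ B ∈ allSubsets n ] h (true ∷ B)
    ≡⟨ ∑-allSubsets-suc n h ⟨
  ∑ (allSubsets (suc n)) h ∎
  where open ≡-Reasoning

∑-allSubsets-∣∣≡0 : ∀ n (h : Subset n → ℚ) →
  ∑[ A ∈ allSubsets n ] (if ∣ A ∣ ≡ᵇ 0 then h A else 0ℚ) ≡ h ⊥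
∑-allSubsets-∣∣≡0 zero    h = +-identityʳ (h [])
∑-allSubsets-∣∣≡0 (suc n) h = begin
  ∑[ A ∈ allSubsets (suc n) ] (if ∣ A ∣ ≡ᵇ 0 then h A else 0ℚ)
    ≡⟨ ∑-allSubsets-suc n (λ A → if ∣ A ∣ ≡ᵇ 0 then h A else 0ℚ) ⟩
  ∑[ B ∈ allSubsets n ] (if ∣ B ∣ ≡ᵇ 0 then h (false ∷ B) else 0ℚ) + ∑[ B ∈ allSubsets n ] 0ℚ
    ≡⟨ cong₂ _+_ (∑-allSubsets-∣∣≡0 n (h ∘ (false ∷_))) (∑-0 (allSubsets n)) ⟩
  h ⊥ + 0ℚ
    ≡⟨ +-identityʳ (h ⊥) ⟩
  h ⊥ ∎
  where open ≡-Reasoning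

-- Binomial coefficients

absorption : ∀ n k → suc k ℕ.* (suc n C suc k) ≡ suc n ℕ.* (n C k)
absorption zero    zero    = refl
absorption zero    (suc k) = ℕ.*-zeroʳ (suc (suc k))
absorption (suc n) zero    =
  trans (ℕ.*-identityˡ _) (trans (nC1≡n (suc (suc n))) (sym (ℕ.*-identityʳ _)))
absorption (suc n) (suc k) = begin
  suc (suc k) ℕ.* (suc N C suc (suc k))
    ≡⟨ cong (suc (suc k) ℕ.*_) (nCk+nC[k+1]≡[n+1]C[k+1] N (suc k)) ⟨
  suc (suc k) ℕ.* (N C suc k ℕ.+ N C suc (suc k))
    ≡⟨ distrib (suc k) (N C suc k) (N C suc (suc k)) ⟩
  N C suc k ℕ.+ (suc k ℕ.* (N C suc k) ℕ.+ suc (suc k) ℕ.* (N C suc (suc k)))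
    ≡⟨ cong₂ (λ u v → N C suc k ℕ.+ (u ℕ.+ v)) (absorption n k) (absorption n (suc k)) ⟩
  N C suc k ℕ.+ (N ℕ.* (n C k) ℕ.+ N ℕ.* (n C suc k))
    ≡⟨ cong (N C suc k ℕ.+_) (ℕ.*-distribˡ-+ N (n C k) (n C suc k)) ⟨
  N C suc k ℕ.+ N ℕ.* (n C k ℕ.+ n C suc k)
    ≡⟨ cong (λ u → N C suc k ℕ.+ N ℕ.* u) (nCk+nC[k+1]≡[n+1]C[k+1] n k) ⟩
  suc N ℕ.* (N C suc k) ∎
  where
  open ≡-Reasoning
  N = suc n
  distrib : ∀ k a b → suc k ℕ.* (a ℕ.+ b) ≡ a ℕ.+ (k ℕ.* a ℕ.+ suc k ℕ.* b)
  distrib = solve-∀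

0<nCk : ∀ n k → k ℕ.≤ n → 0 ℕ.< n C k
0<nCk n       zero    _         = ℕ.≤-refl
0<nCk (suc n) (suc k) (s≤s k≤n) = begin-strict
  0                       <⟨ 0<nCk n k k≤n ⟩
  n C k                   ≤⟨ ℕ.m≤m+n (n C k) (n C suc k) ⟩
  n C k ℕ.+ n C suc k     ≡⟨ nCk+nC[k+1]≡[n+1]C[k+1] n k ⟩
  suc n C suc k           ∎
  where open ℕ.≤-Reasoning

fromℕ-*-invℕ-C : ∀ m k → k ℕ.≤ suc m →
  fromℕ (suc m) * invℕ (suc m C k)
    ≡ fromℕ k * invℕ (m C (k ∸ 1)) + (if k ≡ᵇ 0 then fromℕ (suc m) else 0ℚ)
fromℕ-*-invℕ-C m zero    _         = trans (*-identityʳ (fromℕ (suc m)))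
  (sym (trans (cong (_+ fromℕ (suc m)) (*-zeroˡ (invℕ (m C 0)))) (+-identityˡ _)))
fromℕ-*-invℕ-C m (suc k) (s≤s k≤m) = trans
  (sym (fromℕ-*-invℕ-cross {suc k} {suc m} {suc m C suc k} {m C k}
         (0<nCk (suc m) (suc k) (s≤s k≤m)) (0<nCk m k k≤m) (absorption m k)))
  (sym (+-identityʳ _))

nC∣∁p∣≡nC∣p∣ : ∀ {n} (p : Subset n) → n C ∣ ∁ p ∣ ≡ n C ∣ p ∣
nC∣∁p∣≡nC∣p∣ {n} p = trans (cong (n C_) (∣∁p∣≡n∸∣p∣ p)) (sym (nCk≡nC[n∸k] (∣p∣≤n p)))

-- The binomial norm

binomWeight : ∀ n → Family n → Subset n → ℚ
binomWeight n F A = if F A then invℕ (n C ∣ A ∣) else 0ℚ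

binomNorm-cong : ∀ {n} {F G : Family n} → (∀ A → F A ≡ G A) → binomNorm n F ≡ binomNorm n G
binomNorm-cong {n} F≗G =
  ∑-cong (allSubsets n) (λ A → cong (λ b → if b then invℕ (n C ∣ A ∣) else 0ℚ) (F≗G A))

binomNorm-∁ : ∀ n (F : Family n) → binomNorm n (F ∘ ∁) ≡ binomNorm n F
binomNorm-∁ n F = trans
  (∑-cong (allSubsets n) (λ A → cong (λ k → if F (∁ A) then invℕ k else 0ℚ) (sym (nC∣∁p∣≡nC∣p∣ A))))
  (∑-allSubsets-∁ n (binomWeight n F))

restrict : ∀ {m} → Family (suc m) → Fin (suc m) → Bool → Family m
restrict F i c B = F (insertAt B i c)

module _ {m : ℕ} (F : Family (suc m)) where

  private
    N = suc m

    -- At A = ⊥ the truncated ∣ A ∣ ∸ 1 is harmless: this weight only ever appears multiplied by ∣ A ∣.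
    shiftedWeight : Subset N → ℚ
    shiftedWeight A = if F A then invℕ (m C (∣ A ∣ ∸ 1)) else 0ℚ

    binomNorm-restrict-true : ∀ i →
      binomNorm m (restrict F i true) ≡ ∑[ A ∈ allSubsets N ] (if lookup A i then shiftedWeight A else 0ℚ)
    binomNorm-restrict-true i = sym (begin
      ∑[ A ∈ allSubsets N ] h A
        ≡⟨ ∑-allSubsets-insertAt m i h ⟩
      ∑[ B ∈ allSubsets m ] h (insertAt B i false) + ∑[ B ∈ allSubsets m ] h (insertAt B i true)
        ≡⟨ cong₂ _+_ (trans (∑-cong (allSubsets m) h-false) (∑-0 (allSubsets m)))
                     (∑-cong (allSubsets m) h-true) ⟩
      0ℚ + binomNorm m (restrict F i true)
        ≡⟨ +-identityˡ _ ⟩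
      binomNorm m (restrict F i true) ∎)
      where
      open ≡-Reasoning
      h : Subset N → ℚ
      h A = if lookup A i then shiftedWeight A else 0ℚ
      h-false : ∀ B → h (insertAt B i false) ≡ 0ℚ
      h-false B rewrite insertAt-lookup B i false = refl
      h-true : ∀ B → h (insertAt B i true) ≡ binomWeight m (restrict F i true) B
      h-true B rewrite insertAt-lookup B i true | ∣insertAt-true∣ B i = refl

    double-counting :
      ∑[ i ∈ allFin N ] binomNorm m (restrict F i true) ≡ ∑[ A ∈ allSubsets N ] (fromℕ ∣ A ∣ * shiftedWeight A)
    double-counting = begin
      ∑[ i ∈ allFin N ] binomNorm m (restrict F i true)
        ≡⟨ ∑-cong (allFin N) binomNorm-restrict-true ⟩
      ∑[ i ∈ allFin N ] ∑[ A ∈ allSubsets N ] (if lookup A i then shiftedWeight A else 0ℚ)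
        ≡⟨ ∑-comm (allFin N) (allSubsets N) (λ i A → if lookup A i then shiftedWeight A else 0ℚ) ⟩
      ∑[ A ∈ allSubsets N ] ∑[ i ∈ allFin N ] (if lookup A i then shiftedWeight A else 0ℚ)
        ≡⟨ ∑-cong (allSubsets N) (λ A → ∑-allFin-lookup A (shiftedWeight A)) ⟩
      ∑[ A ∈ allSubsets N ] (fromℕ ∣ A ∣ * shiftedWeight A) ∎
      where open ≡-Reasoning

    lost : Subset N → ℚ
    lost A = if F A then fromℕ N else 0ℚ

    binomWeight-split : ∀ A →
      fromℕ N * binomWeight N F A ≡ fromℕ ∣ A ∣ * shiftedWeight A + (if ∣ A ∣ ≡ᵇ 0 then lost A else 0ℚ)
    binomWeight-split A with F A
    ... | true  = fromℕ-*-invℕ-C m ∣ A ∣ (∣p∣≤n A)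
    ... | false = trans (*-zeroʳ (fromℕ N))
      (sym (trans (cong₂ _+_ (*-zeroʳ (fromℕ ∣ A ∣)) (if-eta (∣ A ∣ ≡ᵇ 0))) (+-identityˡ 0ℚ)))

  ∑-binomNorm-restrict-true :
    fromℕ N * binomNorm N F ≡ ∑[ i ∈ allFin N ] binomNorm m (restrict F i true) + (if F ⊥ then fromℕ N else 0ℚ)
  ∑-binomNorm-restrict-true = begin
    fromℕ N * binomNorm N F
      ≡⟨ *-distribˡ-∑ (fromℕ N) (allSubsets N) (binomWeight N F) ⟩
    ∑[ A ∈ allSubsets N ] (fromℕ N * binomWeight N F A)
      ≡⟨ ∑-cong (allSubsets N) binomWeight-split ⟩
    ∑[ A ∈ allSubsets N ] (fromℕ ∣ A ∣ * shiftedWeight A + (if ∣ A ∣ ≡ᵇ 0 then lost A else 0ℚ))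
      ≡⟨ ∑-distrib-+ (allSubsets N) _ _ ⟩
    ∑[ A ∈ allSubsets N ] (fromℕ ∣ A ∣ * shiftedWeight A)
      + ∑[ A ∈ allSubsets N ] (if ∣ A ∣ ≡ᵇ 0 then lost A else 0ℚ)
      ≡⟨ cong₂ _+_ (sym double-counting) (∑-allSubsets-∣∣≡0 N lost) ⟩
    ∑[ i ∈ allFin N ] binomNorm m (restrict F i true) + lost ⊥ ∎
    where open ≡-Reasoning

∑-binomNorm-restrict : ∀ {m} (F : Family (suc m)) b →
  fromℕ (suc m) * binomNorm (suc m) F
    ≡ ∑[ i ∈ allFin (suc m) ] binomNorm m (restrict F i b)
      + (if F (replicate (suc m) (not b)) then fromℕ (suc m) else 0ℚ)
∑-binomNorm-restrict F true = ∑-binomNorm-restrict-true F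
∑-binomNorm-restrict {m} F false = begin
  fromℕ N * binomNorm N F
    ≡⟨ cong (fromℕ N *_) (binomNorm-∁ N F) ⟨
  fromℕ N * binomNorm N (F ∘ ∁)
    ≡⟨ ∑-binomNorm-restrict-true (F ∘ ∁) ⟩
  ∑[ i ∈ allFin N ] binomNorm m (restrict (F ∘ ∁) i true) + (if F (∁ ⊥) then fromℕ N else 0ℚ)
    ≡⟨ cong₂ _+_ (∑-cong (allFin N) restrict-∁)
                 (cong (λ A → if F A then fromℕ N else 0ℚ) (map-replicate not false N)) ⟩
  ∑[ i ∈ allFin N ] binomNorm m (restrict F i false) + (if F ⊤ then fromℕ N else 0ℚ) ∎
  where
  open ≡-Reasoning
  N = suc m
  restrict-∁ : ∀ i → binomNorm m (restrict (F ∘ ∁) i true) ≡ binomNorm m (restrict F i false)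
  restrict-∁ i = trans (binomNorm-cong (λ B → cong F (map-insertAt not true B i)))
                       (binomNorm-∁ m (restrict F i false))

binomNorm-restrict-≤ : ∀ {m} (F : Family (suc m)) b →
  fromℕ (suc m) * binomNorm (suc m) F ≤ ∑[ i ∈ allFin (suc m) ] binomNorm m (restrict F i b) + fromℕ (suc m)
binomNorm-restrict-≤ {m} F b = ≤-trans (≤-reflexive (∑-binomNorm-restrict F b))
  (+-monoʳ-≤ (∑[ i ∈ allFin (suc m) ] binomNorm m (restrict F i b))
    (if-then-0-≤ (F (replicate (suc m) (not b))) (fromℕ-mono-≤ {0} {suc m} z≤n)))

binomNorm-restrict-true-≡ : ∀ {m} (F : Family (suc m)) → F ⊥ ≡ false →
  fromℕ (suc m) * binomNorm (suc m) F ≡ ∑[ i ∈ allFin (suc m) ] binomNorm m (restrict F i true)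
binomNorm-restrict-true-≡ {m} F F⊥≡false = begin
  fromℕ (suc m) * binomNorm (suc m) F       ≡⟨ ∑-binomNorm-restrict-true F ⟩
  S + (if F ⊥ then fromℕ (suc m) else 0ℚ)   ≡⟨ cong (λ c → S + (if c then fromℕ (suc m) else 0ℚ)) F⊥≡false ⟩
  S + 0ℚ                                    ≡⟨ +-identityʳ S ⟩
  S                                         ∎
  where
  open ≡-Reasoning
  S = ∑[ i ∈ allFin (suc m) ] binomNorm m (restrict F i true)

binomNorm-≤ : ∀ n (F : Family n) → binomNorm n F ≤ fromℕ n + (if F ⊥ then 1ℚ else 0ℚ)
binomNorm-≤ zero    F with F []
... | true  = ≤-refl
... | false = ≤-refl
binomNorm-≤ (suc m) F = fromℕ-suc-*-cancelˡ-≤ m (begin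
  fromℕ N * binomNorm N F
    ≡⟨ ∑-binomNorm-restrict-true F ⟩
  ∑[ i ∈ allFin N ] binomNorm m (restrict F i true) + (if F ⊥ then fromℕ N else 0ℚ)
    ≤⟨ +-monoˡ-≤ _ (∑-mono-≤ (allFin N) (λ i → ≤-trans (binomNorm-≤ m _) restricted-bound)) ⟩
  ∑[ i ∈ allFin N ] fromℕ N + (if F ⊥ then fromℕ N else 0ℚ)
    ≡⟨ cong (_+ (if F ⊥ then fromℕ N else 0ℚ)) (∑-allFin-const N (fromℕ N)) ⟩
  fromℕ N * fromℕ N + (if F ⊥ then fromℕ N else 0ℚ)
    ≡⟨ cong (fromℕ N * fromℕ N +_) (*-if-1-0 (fromℕ N) (F ⊥)) ⟨
  fromℕ N * fromℕ N + fromℕ N * (if F ⊥ then 1ℚ else 0ℚ)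
    ≡⟨ *-distribˡ-+ (fromℕ N) (fromℕ N) _ ⟨
  fromℕ N * (fromℕ N + (if F ⊥ then 1ℚ else 0ℚ)) ∎)
  where
  open ≤-Reasoning
  N = suc m
  restricted-bound : ∀ {b} → fromℕ m + (if b then 1ℚ else 0ℚ) ≤ fromℕ N
  restricted-bound {b} = ≤-trans (+-monoʳ-≤ (fromℕ m) (if-1-0-≤-1 b))
    (≤-reflexive (trans (sym (fromℕ-+ m 1)) (cong fromℕ (ℕ.+-comm m 1))))

-- Cross-dependent families

crossDependent⇒∃⊥∉ : ∀ {n d s} (F : Fin s → Family n) → CrossDependent n d s F →
  ∃ λ j → F j ⊥ ≡ false
crossDependent⇒∃⊥∉ {n} {d} {s} F cd =
  map₂ ¬-not (¬∀⟶∃¬ s (λ i → F i ⊥ ≡ true) (λ i → F i ⊥ Bool.≟ true) all-⊥-refuted)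
  where
  all-⊥-refuted : ¬ (∀ i → F i ⊥ ≡ true)
  all-⊥-refuted ⊥∈F = cd (λ _ → ⊥) ⊥∈F (λ _ _ _ → subst Empty (sym (∩-zeroˡ ⊥)) Empty-⊥)
    (ℕ.≤-trans (ℕ.≤-reflexive (trans (cong ∣_∣ (⋃-tabulate-⊥ s)) (∣⊥∣≡0 n))) z≤n)

restrict-CrossDependent : ∀ {m d s} (F : Fin s → Family (suc m)) i (b : Fin s → Bool) →
  (∀ k l → k ≢ l → b k ∧ b l ≡ false) →
  CrossDependent (suc m) (suc d) s F → CrossDependent m d s (λ k → restrict (F k) i (b k))
restrict-CrossDependent {m} {d} {s} F i b b-disjoint cd B B∈F B-disjoint ∣⋃B∣≤d =
  cd lift B∈F lift-disjoint lift-card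
  where
  lift : Fin s → Subset (suc m)
  lift k = insertAt (B k) i (b k)
  lift-disjoint : ∀ k l → k ≢ l → Empty (lift k ∩ lift l)
  lift-disjoint k l k≢l = subst Empty (sym (begin
    lift k ∩ lift l
      ≡⟨ zipWith-insertAt _∧_ (B k) (B l) i (b k) (b l) ⟩
    insertAt (B k ∩ B l) i (b k ∧ b l)
      ≡⟨ cong₂ (λ p c → insertAt p i c) (Empty-unique (B-disjoint k l k≢l)) (b-disjoint k l k≢l) ⟩
    insertAt ⊥ i false
      ≡⟨ insertAt-replicate m i false ⟩
    ⊥ ∎)) Empty-⊥
    where open ≡-Reasoning
  lift-card : ∣ ⋃ (tabulate lift) ∣ ℕ.≤ suc d
  lift-card = begin
    ∣ ⋃ (tabulate lift) ∣                              ≡⟨ cong ∣_∣ (⋃-tabulate-insertAt s B b i) ⟩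
    ∣ insertAt (⋃ (tabulate B)) i (or (tabulate b)) ∣  ≤⟨ ∣insertAt∣≤1+∣p∣ (⋃ (tabulate B)) i (or (tabulate b)) ⟩
    suc ∣ ⋃ (tabulate B) ∣                             ≤⟨ s≤s ∣⋃B∣≤d ⟩
    suc d                                              ∎
    where open ℕ.≤-Reasoning

≟-at-most-one : ∀ {s} (j : Fin s) k l → k ≢ l → does (k ≟ j) ∧ does (l ≟ j) ≡ false
≟-at-most-one j k l k≢l with k ≟ j | l ≟ j
... | yes refl | yes refl = ⊥-elim (k≢l refl)
... | yes _    | no _     = refl
... | no _     | _        = refl

crossDependent⇒∑-binomNorm-≤-zero : ∀ n s (F : Fin s → Family n) → CrossDependent n 0 s F →
  ∑[ i ∈ allFin s ] binomNorm n (F i) + 1ℚ ≤ fromℕ (suc n ℕ.* s)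
crossDependent⇒∑-binomNorm-≤-zero n s F cd with crossDependent⇒∃⊥∉ F cd
... | j , F[j]⊥≡false = begin
  ∑[ i ∈ allFin s ] binomNorm n (F i) + 1ℚ
    ≤⟨ ∑-allFin-≤-+-except j 1ℚ F-bound F[j]-bound ⟩
  ∑[ i ∈ allFin s ] fromℕ n + fromℕ s * 1ℚ
    ≡⟨ cong₂ _+_ (∑-allFin-const s (fromℕ n)) (*-identityʳ (fromℕ s)) ⟩
  fromℕ s * fromℕ n + fromℕ s
    ≡⟨ trans (fromℕ-+ (s ℕ.* n) s) (cong (_+ fromℕ s) (fromℕ-* s n)) ⟨
  fromℕ (s ℕ.* n ℕ.+ s)
    ≡⟨ cong fromℕ (trans (ℕ.+-comm (s ℕ.* n) s) (cong (s ℕ.+_) (ℕ.*-comm s n))) ⟩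
  fromℕ (suc n ℕ.* s) ∎
  where
  open ≤-Reasoning
  F-bound : ∀ i → binomNorm n (F i) ≤ fromℕ n + 1ℚ
  F-bound i = ≤-trans (binomNorm-≤ n (F i)) (+-monoʳ-≤ (fromℕ n) (if-1-0-≤-1 (F i ⊥)))
  F[j]-bound : binomNorm n (F j) ≤ fromℕ n
  F[j]-bound = begin
    binomNorm n (F j)                      ≤⟨ binomNorm-≤ n (F j) ⟩
    fromℕ n + (if F j ⊥ then 1ℚ else 0ℚ)   ≡⟨ cong (λ c → fromℕ n + (if c then 1ℚ else 0ℚ)) F[j]⊥≡false ⟩
    fromℕ n + 0ℚ                           ≡⟨ +-identityʳ (fromℕ n) ⟩
    fromℕ n                                ∎

combine-≤ : ∀ {n x t e p q} → n * x + n ≤ t + q * n → t + n * e ≤ n * p →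
  n * (x + (1ℚ + e)) ≤ n * (p + q)
combine-≤ {n} {x} {t} {e} {p} {q} h₁ h₂ = begin
  n * (x + (1ℚ + e))
    ≡⟨ solve 4 (λ n x e one → n :* (x :+ (one :+ e)) := n :* x :+ n :* one :+ n :* e) refl n x e 1ℚ ⟩
  n * x + n * 1ℚ + n * e ≡⟨ cong (λ y → n * x + y + n * e) (*-identityʳ n) ⟩
  n * x + n + n * e      ≤⟨ +-monoˡ-≤ (n * e) h₁ ⟩
  t + q * n + n * e      ≡⟨ solve 4 (λ t q n e → t :+ q :* n :+ n :* e := t :+ n :* e :+ q :* n) refl t q n e ⟩
  t + n * e + q * n      ≤⟨ +-monoˡ-≤ (q * n) h₂ ⟩
  n * p + q * n          ≡⟨ solve 3 (λ n p q → n :* p :+ q :* n := n :* (p :+ q)) refl n p q ⟩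
  n * (p + q)            ∎
  where
  open ≤-Reasoning
  open +-*-Solver

crossDependent⇒∑-binomNorm-≤-suc : ∀ m d s (F : Fin s → Family (suc m)) →
  (∀ G → CrossDependent m d s G → ∑[ i ∈ allFin s ] binomNorm m (G i) + fromℕ (suc d) ≤ fromℕ (suc m ℕ.* s)) →
  CrossDependent (suc m) (suc d) s F →
  ∑[ i ∈ allFin s ] binomNorm (suc m) (F i) + fromℕ (suc (suc d)) ≤ fromℕ (suc (suc m) ℕ.* s)
crossDependent⇒∑-binomNorm-≤-suc m d s F ih cd with crossDependent⇒∃⊥∉ F cd
... | j , F[j]⊥≡false = fromℕ-suc-*-cancelˡ-≤ m (begin
  n * (X + fromℕ (suc (suc d)))
    ≡⟨ cong (λ e → n * (X + e)) (fromℕ-+ 1 (suc d)) ⟩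
  n * (X + (1ℚ + D))
    ≤⟨ combine-≤ {n} {X} {∑ (allFin s) T} {D} {M} {fromℕ s} lower upper ⟩
  n * (M + fromℕ s)
    ≡⟨ cong (n *_) (trans (sym (fromℕ-+ (N ℕ.* s) s)) (cong fromℕ (ℕ.+-comm (N ℕ.* s) s))) ⟩
  n * fromℕ (suc N ℕ.* s) ∎)
  where
  open ≤-Reasoning
  N = suc m
  n = fromℕ N
  D = fromℕ (suc d)
  M = fromℕ (N ℕ.* s)
  X = ∑[ i ∈ allFin s ] binomNorm N (F i)
  b : Fin s → Bool
  b i = does (i ≟ j)
  T : Fin s → ℚ
  T i = ∑[ x ∈ allFin N ] binomNorm m (restrict (F i) x (b i))

  F[j]-bound : n * binomNorm N (F j) ≤ T j
  F[j]-bound = subst (λ c → n * binomNorm N (F j) ≤ ∑[ x ∈ allFin N ] binomNorm m (restrict (F j) x c))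
    (sym (dec-true (j ≟ j) refl)) (≤-reflexive (binomNorm-restrict-true-≡ (F j) F[j]⊥≡false))

  lower : n * X + n ≤ ∑ (allFin s) T + fromℕ s * n
  lower = begin
    n * X + n
      ≡⟨ cong (_+ n) (*-distribˡ-∑ n (allFin s) (λ i → binomNorm N (F i))) ⟩
    ∑[ i ∈ allFin s ] (n * binomNorm N (F i)) + n
      ≤⟨ ∑-allFin-≤-+-except j n (λ i → binomNorm-restrict-≤ (F i) (b i)) F[j]-bound ⟩
    ∑ (allFin s) T + fromℕ s * n ∎

  upper : ∑ (allFin s) T + n * D ≤ n * M
  upper = begin
    ∑ (allFin s) T + n * D
      ≡⟨ cong₂ _+_ (∑-comm (allFin s) (allFin N) (λ i x → binomNorm m (restrict (F i) x (b i))))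
                   (sym (∑-allFin-const N D)) ⟩
    ∑[ x ∈ allFin N ] ∑[ i ∈ allFin s ] binomNorm m (restrict (F i) x (b i)) + ∑[ x ∈ allFin N ] D
      ≡⟨ ∑-distrib-+ (allFin N) (λ x → ∑[ i ∈ allFin s ] binomNorm m (restrict (F i) x (b i))) (λ _ → D) ⟨
    ∑[ x ∈ allFin N ] (∑[ i ∈ allFin s ] binomNorm m (restrict (F i) x (b i)) + D)
      ≤⟨ ∑-mono-≤ (allFin N) (λ x → ih _ (restrict-CrossDependent F x b (≟-at-most-one j) cd)) ⟩
    ∑[ x ∈ allFin N ] M
      ≡⟨ ∑-allFin-const N M ⟩
    n * M ∎

crossDependent⇒∑-binomNorm-≤ : ∀ n d s → d ℕ.≤ n → (F : Fin s → Family n) → CrossDependent n d s F →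
  ∑[ i ∈ allFin s ] binomNorm n (F i) + fromℕ (suc d) ≤ fromℕ (suc n ℕ.* s)
crossDependent⇒∑-binomNorm-≤ n       zero    s _         F = crossDependent⇒∑-binomNorm-≤-zero n s F
crossDependent⇒∑-binomNorm-≤ (suc m) (suc d) s (s≤s d≤m) F =
  crossDependent⇒∑-binomNorm-≤-suc m d s F (crossDependent⇒∑-binomNorm-≤ m d s d≤m)

theorem2p2 : (n d s : ℕ) → d ℕ.≤ n → 1 ℕ.≤ s →
    (𝓕 : Fin s → Family n) → CrossDependent n d s 𝓕 →
    sumℚ (map (λ i → binomNorm n (𝓕 i)) (allFin s))
    ≤ (ℤ.+ ((n ℕ.+ 1) ℕ.* s) / 1) - (ℤ.+ (d ℕ.+ 1) / 1)
theorem2p2 n d s d≤n _ 𝓕 cd = begin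
  X
    ≡⟨ solve 2 (λ x e → x := x :+ e :- e) refl X (fromℕ (suc d)) ⟩
  X + fromℕ (suc d) - fromℕ (suc d)
    ≤⟨ +-monoˡ-≤ (- fromℕ (suc d)) (crossDependent⇒∑-binomNorm-≤ n d s d≤n 𝓕 cd) ⟩
  fromℕ (suc n ℕ.* s) - fromℕ (suc d)
    ≡⟨ cong₂ (λ a e → fromℕ (a ℕ.* s) - fromℕ e) (ℕ.+-comm 1 n) (ℕ.+-comm 1 d) ⟩
  fromℕ ((n ℕ.+ 1) ℕ.* s) - fromℕ (d ℕ.+ 1) ∎
  where
  open ≤-Reasoning
  open +-*-Solver
  X = ∑[ i ∈ allFin s ] binomNorm n (𝓕 i)
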